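{- For every integer $\ell \geq 3$ and every positive integer $n$ divisible by $2^{\ell-1}$, we have $\frac{(\ell-1)!}{2}\,n \leq \mathrm{ex}^*(n, C_\ell, P_\ell)$.
   Context: An edge-coloring of a graph is proper if any two edges sharing a vertex receive different colors. An edge-colored graph is rainbow if no two of its edges receive the same color; a rainbow-$F$ is a rainbow subgraph isomorphic to $F$. $P_\ell$ denotes the path with $\ell$ edges ($\ell+1$ vertices) and $C_\ell$ the cycle of length $\ell$. For graphs $H$ and $F$, $\mathrm{ex}^*(n,H,F)$ is the maximum number of rainbow copies of $H$ (as subgraphs) in an $n$-vertex simple graph with a proper edge-coloring that contains no rainbow copy of $F$. -}

module Defs where

open import Data.Nat using (ℕ; zero; suc; _≤_; _+_)
open import Data.Bool using (Bool; true; false; _∧_; _∨_; not)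
open import Data.Fin using (Fin; toℕ)
import Data.Fin as F
open import Data.Fin.Properties using () renaming (_≟_ to _≟F_)
open import Data.Bool.Properties using () renaming (_≟_ to _≟B_)
open import Data.List using (List; []; _∷_; map; filter; length; concatMap; deduplicate; allFin)
open import Data.List.Relation.Unary.All using (All)
open import Data.Vec using (Vec; []; _∷_; lookup; tabulate)
open import Data.Vec.Properties using (≡-dec)
open import Data.Product using (Σ; _×_; _,_)
open import Relation.Nullary using (¬_; does)
open import Relation.Binary.PropositionalEquality using (_≡_; _≢_)

Graph : ℕ → Set
Graph n = Fin n → Fin n → Bool

record Simple {n : ℕ} (G : Graph n) : Set where
  field
    sym     : ∀ u v → G u v ≡ G v u
    irrefl  : ∀ u → G u u ≡ false

_==_ : ∀ {n} → Fin n → Fin n → Bool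
a == b = does (a ≟F b)

_==ℕ_ : ℕ → ℕ → Bool
a ==ℕ b = does (a Data.Nat.≟ b)
  where import Data.Nat

allF : ∀ {k} → (Fin k → Bool) → Bool
allF {k} p = Data.List.foldr (λ x b → p x ∧ b) true (allFin k)

anyF : ∀ {k} → (Fin k → Bool) → Bool
anyF {k} p = Data.List.foldr (λ x b → p x ∨ b) false (allFin k)

-- The cycle C_ℓ on Fin ℓ (i ~ i+1, and 0 ~ ℓ-1), and the path P_ℓ
-- with ℓ edges on Fin (ℓ+1) (i ~ i+1).

cycleG : (ℓ : ℕ) → Graph ℓ
cycleG ℓ u v =
  not (u == v) ∧
  ( (suc (toℕ u) ==ℕ toℕ v) ∨ (suc (toℕ v) ==ℕ toℕ u)
  ∨ ((toℕ u ==ℕ 0) ∧ (suc (toℕ v) ==ℕ ℓ))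
  ∨ ((toℕ v ==ℕ 0) ∧ (suc (toℕ u) ==ℕ ℓ)) )

pathG : (ℓ : ℕ) → Graph (suc ℓ)
pathG ℓ u v = (suc (toℕ u) ==ℕ toℕ v) ∨ (suc (toℕ v) ==ℕ toℕ u)

Coloring : ℕ → Set
Coloring n = Fin n → Fin n → ℕ

record ProperColoring {n : ℕ} (G : Graph n) (c : Coloring n) : Set where
  field
    symm   : ∀ u v → G u v ≡ true → c u v ≡ c v u
    proper : ∀ u v w → G u v ≡ true → G u w ≡ true → v ≢ w → c u v ≢ c u w

-- Copies of H (on Fin k) in G (on Fin n): images of injective
-- edge-preserving maps φ : Fin k → Fin n.  A map is represented by the
-- vector of its values.

allVecs : ∀ {n} (k : ℕ) → List (Vec (Fin n) k)
allVecs zero = [] ∷ []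
allVecs {n} (suc k) = concatMap (λ x → map (x ∷_) (allVecs k)) (allFin n)

module _ {k n : ℕ} (H : Graph k) (G : Graph n) (c : Coloring n) where

  injB : Vec (Fin n) k → Bool
  injB φ = allF λ u → allF λ v → not (lookup φ u == lookup φ v) ∨ (u == v)

  homB : Vec (Fin n) k → Bool
  homB φ = allF λ u → allF λ v → not (H u v) ∨ G (lookup φ u) (lookup φ v)

  rainbowB : Vec (Fin n) k → Bool
  rainbowB φ =
    allF λ u → allF λ v → allF λ u' → allF λ v' →
      not (H u v ∧ H u' v')
      ∨ ((u == u') ∧ (v == v')) ∨ ((u == v') ∧ (v == u'))
      ∨ not (c (lookup φ u) (lookup φ v) ==ℕ c (lookup φ u') (lookup φ v'))

  rainbowEmb : Vec (Fin n) k → Bool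
  rainbowEmb φ = injB φ ∧ homB φ ∧ rainbowB φ

  Sub : Set
  Sub = Vec Bool n × Vec (Vec Bool n) n

  image : Vec (Fin n) k → Sub
  image φ =
    tabulate (λ x → anyF λ u → lookup φ u == x) ,
    tabulate (λ x → tabulate (λ y → anyF λ u → anyF λ v →
      H u v ∧ (((lookup φ u == x) ∧ (lookup φ v == y))
              ∨ ((lookup φ u == y) ∧ (lookup φ v == x)))))

  _≟Sub_ : (a b : Sub) → Relation.Nullary.Dec (a ≡ b)
  (a , e) ≟Sub (b , f) with ≡-dec _≟B_ a b | ≡-dec (≡-dec _≟B_) e f
  ... | Relation.Nullary.yes Relation.Binary.PropositionalEquality.refl
      | Relation.Nullary.yes Relation.Binary.PropositionalEquality.refl
      = Relation.Nullary.yes Relation.Binary.PropositionalEquality.refl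
  ... | Relation.Nullary.no p | _ =
        Relation.Nullary.no λ { Relation.Binary.PropositionalEquality.refl → p Relation.Binary.PropositionalEquality.refl }
  ... | Relation.Nullary.yes _ | Relation.Nullary.no q =
        Relation.Nullary.no λ { Relation.Binary.PropositionalEquality.refl → q Relation.Binary.PropositionalEquality.refl }

  rainbowCount : ℕ
  rainbowCount =
    length (deduplicate _≟Sub_
      (map image (filter (λ φ → rainbowEmb φ Data.Bool.≟ true) (allVecs k))))

  NoRainbow : Set
  NoRainbow = ∀ (φ : Vec (Fin n) k) → rainbowEmb φ ≡ false

record IsExStar (n : ℕ) {k j : ℕ} (H : Graph k) (Fg : Graph j) (m : ℕ) : Set where
  field
    attained : Σ (Graph n) λ G → Σ (Coloring n) λ c →
      Simple G × ProperColoring G c × NoRainbow Fg G c × rainbowCount H G c ≡ m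
    upper : ∀ (G : Graph n) (c : Coloring n) →
      Simple G → ProperColoring G c → NoRainbow Fg G c → rainbowCount H G c ≤ m

-- Take q disjoint copies of the folded (k+1)-cube, k = ℓ - 1: the vertices of a copy are the
-- bit vectors {0,1}^k, and u ~ v when u ⊕ v is one of the k + 1 generators e₁, …, e_k,
-- 1 = e₁ ⊕ … ⊕ e_k; an edge is coloured by its generator, which makes the colouring proper.
-- A rainbow path with k + 1 edges uses every generator exactly once, and the generators sum
-- to 0, so it ends where it started: there is no rainbow P_ℓ. On the other hand, a start x
-- with x₁ = 0 and an order of e₁, …, e_k give the rainbow C_ℓ that adds the unit vectors in
-- this order and closes with 1. Its closing edge recovers x and the positions of its
-- vertices recover the order, so these q · 2^(k-1) · k! ≥ (k!/2) · n rainbow cycles are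
-- pairwise distinct.

module Submission where

open import Defs
open import Algebra.Bundles using (CommutativeMonoid; CommutativeRing)
open import Data.Bool using (Bool; true; false; _∧_; _∨_; not; _xor_)
import Data.Bool as Bool
open import Data.Bool.Properties
  using (∨-zeroʳ; xor-∧-commutativeRing; xor-assoc; xor-comm; xor-same; xor-identityˡ; xor-identityʳ)
open import Data.Empty using (⊥-elim)
open import Data.Fin as F using (Fin; toℕ; inject₁; fromℕ; fromℕ<; remQuot; combine; punchIn; punchOut)
open import Data.Fin.Induction using (<-weakInduction)
open import Data.Fin.Permutation as Perm
  using (Permutation′; permutation; _⟨$⟩ʳ_; _⟨$⟩ˡ_; insert; insert-punchIn; lift₀; inverseˡ; inverseʳ)
open import Data.Fin.Properties
  using (2↔Bool; any?; injective⇒≤; punchOut-injective; punchIn-injective; combine-remQuot; remQuot-combine;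
         toℕ-injective; toℕ-inject₁; toℕ-fromℕ; toℕ-fromℕ<; toℕ<n; suc-injective; <-cmp; ≤-antisym)
open import Data.List using ([]; _∷_; foldr; length; map; deduplicate; allFin)
import Data.List as List
open import Data.List.Membership.Propositional using (_∈_)
open import Data.List.Membership.Propositional.Properties
  using (∈-map⁺; ∈-filter⁺; ∈-concatMap⁺; ∈-deduplicate⁺; ∈-allFin)
open import Data.List.Relation.Unary.Any using (here; there; index)
import Data.List.Relation.Unary.Any as Any
open import Data.List.Relation.Unary.Any.Properties using (lookup-index)
open import Data.Nat using (ℕ; zero; suc; _+_; _*_; _^_; _!; _/_; _∸_; _≤_; _<_; z≤n; s≤s; s≤s⁻¹; _≟_; _<?_)
import Data.Nat.Properties as ℕₚ
open import Data.Nat.DivMod using (m/n*n≤m)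
open import Data.Nat.Divisibility using (_∣_; divides)
open import Data.Nat.Tactic.RingSolver using (solve-∀)
open import Data.Product using (∃; ∃₂; _×_; _,_; proj₁; proj₂)
open import Data.Sum using (_⊎_; inj₁; inj₂)
open import Data.Vec using (Vec; []; _∷_; lookup; tabulate; replicate; zipWith)
open import Data.Vec.Properties
  using (≡-dec; lookup∘tabulate; tabulate∘lookup; tabulate-cong; lookup-replicate; lookup-zipWith; map-id;
         zipWith-comm; zipWith-assoc; zipWith-identityˡ; zipWith-identityʳ; zipWith-inverseˡ; zipWith-replicate;
         ∷-injectiveʳ)
open import Function.Base using (_∘_; _∘′_)
open import Function.Bundles using (Inverse; Injection; mk⇔)
open import Function.Definitions using (Injective)
open import Function.Properties.Inverse using (↔⇒↣)
open import Relation.Binary.Definitions using (DecidableEquality; tri<; tri≈; tri>)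
open import Relation.Binary.PropositionalEquality
open import Relation.Nullary using (Dec; yes; no; does; ¬_)
open import Relation.Nullary.Decidable using (dec-true; dec-false; does-⇔; _×-dec_)
open import Relation.Nullary.Negation using (contradiction)

dec-true⁻ : ∀ {p} {P : Set p} (P? : Dec P) → does P? ≡ true → P
dec-true⁻ (yes p) _ = p

dec-false⁻ : ∀ {p} {P : Set p} (P? : Dec P) → does P? ≡ false → ¬ P
dec-false⁻ (no ¬p) _ = ¬p

==⇒≡ : ∀ {n} {a b : Fin n} → (a == b) ≡ true → a ≡ b
==⇒≡ {a = a} {b} = dec-true⁻ (a F.≟ b)

≡⇒== : ∀ {n} {a b : Fin n} → a ≡ b → (a == b) ≡ true
≡⇒== {a = a} {b} = dec-true (a F.≟ b)

==-refl : ∀ {n} (a : Fin n) → (a == a) ≡ true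
==-refl a = dec-true (a F.≟ a) refl

==ℕ⇒≡ : ∀ {a b : ℕ} → (a ==ℕ b) ≡ true → a ≡ b
==ℕ⇒≡ {a} {b} = dec-true⁻ (a ≟ b)

≡⇒==ℕ : ∀ {a b : ℕ} → a ≡ b → (a ==ℕ b) ≡ true
≡⇒==ℕ {a} {b} = dec-true (a ≟ b)

∧-true⁻ : ∀ {a b} → (a ∧ b) ≡ true → a ≡ true × b ≡ true
∧-true⁻ {true} {true} _ = refl , refl

∧-true⁺ : ∀ {a b} → a ≡ true → b ≡ true → (a ∧ b) ≡ true
∧-true⁺ refl refl = refl

∨-true⁻ : ∀ {a b} → (a ∨ b) ≡ true → a ≡ true ⊎ b ≡ true
∨-true⁻ {true} _ = inj₁ refl
∨-true⁻ {false} e = inj₂ e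

⇒-true⁻ : ∀ {a b} → (not a ∨ b) ≡ true → a ≡ true → b ≡ true
⇒-true⁻ e refl = e

⇒-true⁺ : ∀ {a b} → (a ≡ true → b ≡ true) → (not a ∨ b) ≡ true
⇒-true⁺ {false} _ = refl
⇒-true⁺ {true} f = f refl

-- The shape of the clause of rainbowB.
∨-not-true⁻ : ∀ {a b c} → (a ∨ b ∨ not c) ≡ true → c ≡ true → (a ∨ b) ≡ true
∨-not-true⁻ {true} _ _ = refl
∨-not-true⁻ {false} {true} _ _ = refl
∨-not-true⁻ {false} {false} {true} () _

∨-not-true⁺ : ∀ {a b c} → (c ≡ true → (a ∨ b) ≡ true) → (a ∨ b ∨ not c) ≡ true
∨-not-true⁺ {true} _ = refl
∨-not-true⁺ {false} {true} _ = refl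
∨-not-true⁺ {false} {false} {false} _ = refl
∨-not-true⁺ {false} {false} {true} f = f refl

allF⁻ : ∀ {k} {p : Fin k → Bool} → allF p ≡ true → ∀ x → p x ≡ true
allF⁻ {k} {p} e x = go (allFin k) e (∈-allFin x)
  where
  go : ∀ xs → foldr (λ x b → p x ∧ b) true xs ≡ true → ∀ {x} → x ∈ xs → p x ≡ true
  go (y ∷ ys) e (here refl) = proj₁ (∧-true⁻ e)
  go (y ∷ ys) e (there x∈ys) = go ys (proj₂ (∧-true⁻ {p y} e)) x∈ys

allF⁺ : ∀ {k} {p : Fin k → Bool} → (∀ x → p x ≡ true) → allF p ≡ true
allF⁺ {k} {p} h = go (allFin k)
  where
  go : ∀ xs → foldr (λ x b → p x ∧ b) true xs ≡ true
  go [] = refl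
  go (y ∷ ys) = ∧-true⁺ (h y) (go ys)

anyF⁻ : ∀ {k} {p : Fin k → Bool} → anyF p ≡ true → ∃ λ x → p x ≡ true
anyF⁻ {k} {p} = go (allFin k)
  where
  go : ∀ xs → foldr (λ x b → p x ∨ b) false xs ≡ true → ∃ λ x → p x ≡ true
  go (y ∷ ys) e with ∨-true⁻ {p y} e
  ... | inj₁ py = y , py
  ... | inj₂ rest = go ys rest

anyF⁺ : ∀ {k} {p : Fin k → Bool} x → p x ≡ true → anyF p ≡ true
anyF⁺ {k} {p} x px = go (∈-allFin x)
  where
  go : ∀ {xs} → x ∈ xs → foldr (λ x b → p x ∨ b) false xs ≡ true
  go (here refl) rewrite px = refl
  go {y ∷ _} (there x∈ys) rewrite go x∈ys = ∨-zeroʳ (p y)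

SameEdge : ∀ {A : Set} → A → A → A → A → Set
SameEdge u v u' v' = (u ≡ u' × v ≡ v') ⊎ (u ≡ v' × v ≡ u')

SameEdge-resp : ∀ {A : Set} {u v u' v' x y x' y' : A} → u ≡ x → v ≡ y → u' ≡ x' → v' ≡ y' →
                SameEdge u v u' v' → SameEdge x y x' y'
SameEdge-resp refl refl refl refl s = s

SameEdge-endpoint : ∀ {A B : Set} (f : A → B) {u v U V : A} {X Y : B} →
                    SameEdge u v U V → SameEdge (f u) (f v) X Y → f V ≡ X ⊎ f V ≡ Y
SameEdge-endpoint f (inj₁ (refl , refl)) (inj₁ (_ , q)) = inj₂ q
SameEdge-endpoint f (inj₁ (refl , refl)) (inj₂ (_ , q)) = inj₁ q
SameEdge-endpoint f (inj₂ (refl , refl)) (inj₁ (p , _)) = inj₁ p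
SameEdge-endpoint f (inj₂ (refl , refl)) (inj₂ (p , _)) = inj₂ p

sameEdgeB : ∀ {n} → Fin n → Fin n → Fin n → Fin n → Bool
sameEdgeB u v u' v' = ((u == u') ∧ (v == v')) ∨ ((u == v') ∧ (v == u'))

sameEdgeB⁻ : ∀ {n} {u v u' v' : Fin n} → sameEdgeB u v u' v' ≡ true → SameEdge u v u' v'
sameEdgeB⁻ {u = u} {v} {u'} {v'} e with ∨-true⁻ {(u == u') ∧ (v == v')} e
... | inj₁ s = let (p , q) = ∧-true⁻ {u == u'} s in inj₁ (==⇒≡ p , ==⇒≡ q)
... | inj₂ w = let (p , q) = ∧-true⁻ {u == v'} w in inj₂ (==⇒≡ p , ==⇒≡ q)

sameEdgeB⁺ : ∀ {n} {u v u' v' : Fin n} → SameEdge u v u' v' → sameEdgeB u v u' v' ≡ true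
sameEdgeB⁺ (inj₁ (p , q)) rewrite ≡⇒== p | ≡⇒== q = refl
sameEdgeB⁺ {u = u} {v} {u'} {v'} (inj₂ (p , q)) rewrite ≡⇒== p | ≡⇒== q =
  ∨-zeroʳ ((u == u') ∧ (v == v'))

record IsRainbowEmbedding {k n} (H : Graph k) (G : Graph n) (c : Coloring n)
                          (φ : Fin k → Fin n) : Set where
  field
    injective : ∀ {u v} → φ u ≡ φ v → u ≡ v
    edge-preserving : ∀ {u v} → H u v ≡ true → G (φ u) (φ v) ≡ true
    rainbow : ∀ {u v u' v'} → H u v ≡ true → H u' v' ≡ true →
              c (φ u) (φ v) ≡ c (φ u') (φ v') → SameEdge u v u' v'

module _ {k n} {H : Graph k} {G : Graph n} {c : Coloring n} where

  IsRainbowEmbedding-cong : ∀ {φ ψ} → (∀ u → φ u ≡ ψ u) →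
    IsRainbowEmbedding H G c φ → IsRainbowEmbedding H G c ψ
  IsRainbowEmbedding-cong {φ} {ψ} φ≗ψ emb = record
    { injective = λ e → injective (trans (φ≗ψ _) (trans e (sym (φ≗ψ _))))
    ; edge-preserving = λ {u} {v} h → subst₂ (λ x y → G x y ≡ true) (φ≗ψ u) (φ≗ψ v) (edge-preserving h)
    ; rainbow = λ {u} {v} {u'} {v'} h h' e → rainbow h h'
        (trans (cong₂ c (φ≗ψ u) (φ≗ψ v)) (trans e (sym (cong₂ c (φ≗ψ u') (φ≗ψ v')))))
    }
    where open IsRainbowEmbedding emb

  rainbowEmb⁻ : ∀ φ → rainbowEmb H G c φ ≡ true → IsRainbowEmbedding H G c (lookup φ)
  rainbowEmb⁻ φ e = record
    { injective = λ {u} {v} eq → ==⇒≡ (⇒-true⁻ (allF⁻ (allF⁻ inj u) v) (≡⇒== eq))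
    ; edge-preserving = λ {u} {v} → ⇒-true⁻ (allF⁻ (allF⁻ hom u) v)
    ; rainbow = λ {u} {v} {u'} {v'} h h' eq → sameEdgeB⁻
        (∨-not-true⁻ {(u == u') ∧ (v == v')}
                     (⇒-true⁻ (allF⁻ (allF⁻ (allF⁻ (allF⁻ rb u) v) u') v') (∧-true⁺ h h'))
                     (≡⇒==ℕ eq))
    }
    where
    inj : injB H G c φ ≡ true
    inj = proj₁ (∧-true⁻ e)
    hom : homB H G c φ ≡ true
    hom = proj₁ (∧-true⁻ (proj₂ (∧-true⁻ {injB H G c φ} e)))
    rb : rainbowB H G c φ ≡ true
    rb = proj₂ (∧-true⁻ {homB H G c φ} (proj₂ (∧-true⁻ {injB H G c φ} e)))

  rainbowEmb⁺ : ∀ φ → IsRainbowEmbedding H G c (lookup φ) → rainbowEmb H G c φ ≡ true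
  rainbowEmb⁺ φ emb = ∧-true⁺ inj (∧-true⁺ hom rb)
    where
    open IsRainbowEmbedding emb
    inj : injB H G c φ ≡ true
    inj = allF⁺ λ u → allF⁺ λ v → ⇒-true⁺ λ eq → ≡⇒== (injective {u} {v} (==⇒≡ eq))
    hom : homB H G c φ ≡ true
    hom = allF⁺ λ u → allF⁺ λ v → ⇒-true⁺ (edge-preserving {u} {v})
    rb : rainbowB H G c φ ≡ true
    rb = allF⁺ λ u → allF⁺ λ v → allF⁺ λ u' → allF⁺ λ v' → ⇒-true⁺ λ hh →
      let (h , h') = ∧-true⁻ hh in
      ∨-not-true⁺ {(u == u') ∧ (v == v')} λ eq → sameEdgeB⁺ (rainbow {u} {v} {u'} {v'} h h' (==ℕ⇒≡ eq))

module _ {k n} (H : Graph k) (G : Graph n) (c : Coloring n) where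

  lookup-vertexTable : ∀ φ x → lookup (proj₁ (image H G c φ)) x ≡ anyF (λ u → lookup φ u == x)
  lookup-vertexTable φ x = lookup∘tabulate _ x

  edgeWitness : Vec (Fin n) k → Fin n → Fin n → Fin k → Fin k → Bool
  edgeWitness φ x y u v = H u v ∧ sameEdgeB (lookup φ u) (lookup φ v) x y

  lookup-edgeTable : ∀ φ x y → lookup (lookup (proj₂ (image H G c φ)) x) y ≡
                     anyF (λ u → anyF (edgeWitness φ x y u))
  lookup-edgeTable φ x y =
    trans (cong (λ r → lookup r y) (lookup∘tabulate _ x)) (lookup∘tabulate _ y)

  image-vertex : ∀ φ ψ → image H G c φ ≡ image H G c ψ →
                 ∀ u → ∃ λ u' → lookup ψ u' ≡ lookup φ u
  image-vertex φ ψ eq u =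
    let (u' , p) = anyF⁻ (trans (sym (lookup-vertexTable ψ x))
                                (subst (λ I → lookup (proj₁ I) x ≡ true) eq φ∋x))
    in u' , ==⇒≡ p
    where
    x : Fin n
    x = lookup φ u
    φ∋x : lookup (proj₁ (image H G c φ)) x ≡ true
    φ∋x = trans (lookup-vertexTable φ x) (anyF⁺ {p = λ u' → lookup φ u' == x} u (==-refl x))

  image-edge : ∀ φ ψ → image H G c φ ≡ image H G c ψ → ∀ {u v} → H u v ≡ true →
               ∃₂ λ u' v' → H u' v' ≡ true × SameEdge (lookup ψ u') (lookup ψ v') (lookup φ u) (lookup φ v)
  image-edge φ ψ eq {u} {v} h =
    let (u' , p) = anyF⁻ (trans (sym (lookup-edgeTable ψ x y))
                                (subst (λ I → lookup (lookup (proj₂ I) x) y ≡ true) eq φ∋xy))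
        (v' , q) = anyF⁻ p
        (h' , same) = ∧-true⁻ q
    in u' , v' , h' , sameEdgeB⁻ same
    where
    x y : Fin n
    x = lookup φ u
    y = lookup φ v
    φ∋xy : lookup (lookup (proj₂ (image H G c φ)) x) y ≡ true
    φ∋xy = trans (lookup-edgeTable φ x y)
      (anyF⁺ {p = λ u' → anyF (edgeWitness φ x y u')} u
        (anyF⁺ {p = edgeWitness φ x y u} v (∧-true⁺ h (sameEdgeB⁺ {u = x} {y} (inj₁ (refl , refl))))))

≤-length-deduplicate : ∀ {A : Set} (_≟_ : DecidableEquality A) {xs K} (f : Fin K → A) →
                       Injective _≡_ _≡_ f → (∀ i → f i ∈ xs) → K ≤ length (deduplicate _≟_ xs)
≤-length-deduplicate _≟_ {xs} f f-injective f∈xs = injective⇒≤ {f = position} position-injective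
  where
  f∈ : ∀ i → f i ∈ deduplicate _≟_ xs
  f∈ i = ∈-deduplicate⁺ _≟_ (f∈xs i)
  position : _ → Fin _
  position i = index (f∈ i)
  position-injective : Injective _≡_ _≡_ position
  position-injective {i} {j} e = f-injective (begin
    f i                                         ≡⟨ lookup-index (f∈ i) ⟩
    List.lookup (deduplicate _≟_ xs) (position i) ≡⟨ cong (List.lookup (deduplicate _≟_ xs)) e ⟩
    List.lookup (deduplicate _≟_ xs) (position j) ≡⟨ lookup-index (f∈ j) ⟨
    f j                                         ∎)
    where open ≡-Reasoning

∈-allVecs : ∀ {n} k (φ : Vec (Fin n) k) → φ ∈ allVecs k
∈-allVecs zero [] = here refl
∈-allVecs (suc k) (x ∷ φ) =
  ∈-concatMap⁺ (λ y → map (y ∷_) (allVecs k))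
    (Any.map (λ { refl → ∈-map⁺ (x ∷_) (∈-allVecs k φ) }) (∈-allFin x))

≤-rainbowCount : ∀ {k n} (H : Graph k) (G : Graph n) (c : Coloring n) {K} (f : Fin K → Vec (Fin n) k) →
                 (∀ i → rainbowEmb H G c (f i) ≡ true) → Injective _≡_ _≡_ (image H G c ∘ f) →
                 K ≤ rainbowCount H G c
≤-rainbowCount {k} H G c f f-rainbow image∘f-injective =
  ≤-length-deduplicate (_≟Sub_ H G c) (image H G c ∘ f) image∘f-injective λ i →
    ∈-map⁺ (image H G c)
      (∈-filter⁺ (λ φ → rainbowEmb H G c φ Bool.≟ true) (∈-allVecs k (f i)) (f-rainbow i))

-- Sums in ℤ₂ and the generators of ℤ₂ᵏ

xor-commutativeMonoid : CommutativeMonoid _ _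
xor-commutativeMonoid = CommutativeRing.+-commutativeMonoid xor-∧-commutativeRing

open import Algebra.Properties.CommutativeMonoid.Sum xor-commutativeMonoid
  using (sum-syntax; sum-cong-≗; sum-permute; sum-replicate-zero)

xor-cancelˡ : ∀ a b → a xor (a xor b) ≡ b
xor-cancelˡ a b = trans (sym (xor-assoc a a b)) (cong (_xor b) (xor-same a))

xor-telescope : ∀ {m} (B : Fin (suc m) → Bool) →
                B (fromℕ m) ≡ B F.zero xor ∑[ i < m ] (B (inject₁ i) xor B (F.suc i))
xor-telescope {zero} B = sym (xor-identityʳ (B F.zero))
xor-telescope {suc m} B = begin
  B (fromℕ (suc m))                                        ≡⟨ xor-telescope (B ∘ F.suc) ⟩
  B (F.suc F.zero) xor S                                   ≡⟨ cong (_xor S) (xor-cancelˡ (B F.zero) _) ⟨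
  (B F.zero xor (B F.zero xor B (F.suc F.zero))) xor S     ≡⟨ xor-assoc (B F.zero) _ S ⟩
  B F.zero xor ((B F.zero xor B (F.suc F.zero)) xor S)     ∎
  where
  open ≡-Reasoning
  S : Bool
  S = ∑[ i < m ] (B (F.suc (inject₁ i)) xor B (F.suc (F.suc i)))

≡-along-steps : ∀ {a} {A : Set a} {m} (f : Fin (suc m) → A) →
                (∀ i → f (inject₁ i) ≡ f (F.suc i)) → f (fromℕ m) ≡ f F.zero
≡-along-steps {m = zero} f step = refl
≡-along-steps {m = suc m} f step =
  trans (≡-along-steps (f ∘ F.suc) (step ∘ F.suc)) (sym (step F.zero))

∑-indicator : ∀ {k} (j : Fin k) → ∑[ i < k ] (i == j) ≡ true
∑-indicator {suc k} F.zero = cong (true xor_) (sum-replicate-zero k)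
∑-indicator {suc k} (F.suc j) = ∑-indicator j

<?-suc : ∀ m n → does (m <? suc n) ≡ does (m <? n) xor does (m ≟ n)
<?-suc m n with ℕₚ.<-cmp m n
... | tri< m<n m≢n _ = trans (dec-true (m <? suc n) (ℕₚ.m<n⇒m<1+n m<n))
  (sym (cong₂ _xor_ (dec-true (m <? n) m<n) (dec-false (m ≟ n) m≢n)))
... | tri≈ m≮m refl _ = trans (dec-true (m <? suc m) (ℕₚ.n<1+n m))
  (sym (cong₂ _xor_ (dec-false (m <? m) m≮m) (dec-true (m ≟ m) refl)))
... | tri> _ m≢n n<m = trans (dec-false (m <? suc n) (ℕₚ.<⇒≱ n<m ∘ s≤s⁻¹))
  (sym (cong₂ _xor_ (dec-false (m <? n) (ℕₚ.<⇒≯ n<m)) (dec-false (m ≟ n) m≢n)))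

infixl 6 _⊕_

_⊕_ : ∀ {k} → Vec Bool k → Vec Bool k → Vec Bool k
_⊕_ = zipWith _xor_

lookup-⊕ : ∀ {k} (x y : Vec Bool k) j → lookup (x ⊕ y) j ≡ lookup x j xor lookup y j
lookup-⊕ x y j = lookup-zipWith _xor_ j x y

⊕-comm : ∀ {k} (x y : Vec Bool k) → x ⊕ y ≡ y ⊕ x
⊕-comm = zipWith-comm xor-comm

⊕-self : ∀ {k} (x : Vec Bool k) → x ⊕ x ≡ replicate k false
⊕-self x = trans (cong (_⊕ x) (sym (map-id x))) (zipWith-inverseˡ xor-same x)

⊕-cancelˡ : ∀ {k} (x y : Vec Bool k) → x ⊕ (x ⊕ y) ≡ y
⊕-cancelˡ x y = begin
  x ⊕ (x ⊕ y)   ≡⟨ zipWith-assoc xor-assoc x x y ⟨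
  (x ⊕ x) ⊕ y   ≡⟨ cong (_⊕ y) (⊕-self x) ⟩
  replicate _ false ⊕ y ≡⟨ zipWith-identityˡ xor-identityˡ y ⟩
  y             ∎
  where open ≡-Reasoning

⊕-injectiveʳ : ∀ {k} (x : Vec Bool k) {y z} → x ⊕ y ≡ x ⊕ z → y ≡ z
⊕-injectiveʳ x {y} {z} e = trans (sym (⊕-cancelˡ x y)) (trans (cong (x ⊕_) e) (⊕-cancelˡ x z))

⊕-cancel-common : ∀ {k} (x y z : Vec Bool k) → (x ⊕ y) ⊕ (x ⊕ z) ≡ y ⊕ z
⊕-cancel-common x y z = begin
  (x ⊕ y) ⊕ (x ⊕ z)   ≡⟨ cong (_⊕ (x ⊕ z)) (⊕-comm x y) ⟩
  (y ⊕ x) ⊕ (x ⊕ z)   ≡⟨ zipWith-assoc xor-assoc y x (x ⊕ z) ⟩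
  y ⊕ (x ⊕ (x ⊕ z))   ≡⟨ cong (y ⊕_) (⊕-cancelˡ x z) ⟩
  y ⊕ z               ∎
  where open ≡-Reasoning

≗⇒≡ : ∀ {a} {A : Set a} {k} {x y : Vec A k} → (∀ j → lookup x j ≡ lookup y j) → x ≡ y
≗⇒≡ {x = x} {y} x≗y = trans (sym (tabulate∘lookup x)) (trans (tabulate-cong x≗y) (tabulate∘lookup y))

gen : ∀ {k} → Fin (suc k) → Vec Bool k
gen F.zero = replicate _ true
gen (F.suc j) = tabulate (j ==_)

∑-gen : ∀ {k} (j : Fin k) → ∑[ t < suc k ] lookup (gen t) j ≡ false
∑-gen j = cong₂ _xor_ (lookup-replicate j true)
  (trans (sum-cong-≗ λ i → lookup∘tabulate (i ==_) j) (∑-indicator j))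

gen-nonzero : ∀ {a} (t : Fin (2 + a)) → gen t ≢ replicate _ false
gen-nonzero F.zero e = contradiction (cong (λ v → lookup v F.zero) e) λ ()
gen-nonzero (F.suc j) e =
  contradiction (trans (sym (trans (lookup∘tabulate (j ==_) j) (==-refl j)))
                       (trans (cong (λ v → lookup v j) e) (lookup-replicate j false))) λ ()

gen-suc≢gen-zero : ∀ {a} (j : Fin (2 + a)) → gen (F.suc j) ≢ gen F.zero
gen-suc≢gen-zero F.zero e = contradiction (cong (λ v → lookup v (F.suc F.zero)) e) λ ()
gen-suc≢gen-zero (F.suc j) e = contradiction (cong (λ v → lookup v F.zero) e) λ ()

gen-injective : ∀ {a} → Injective _≡_ _≡_ (gen {2 + a})
gen-injective {x = F.zero} {F.zero} _ = refl
gen-injective {x = F.zero} {F.suc j} e = contradiction (sym e) (gen-suc≢gen-zero j)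
gen-injective {x = F.suc i} {F.zero} e = contradiction e (gen-suc≢gen-zero i)
gen-injective {x = F.suc i} {F.suc j} e = cong F.suc (sym (==⇒≡ (begin
  (j == i)                  ≡⟨ lookup∘tabulate (j ==_) i ⟨
  lookup (gen (F.suc j)) i  ≡⟨ cong (λ v → lookup v i) e ⟨
  lookup (gen (F.suc i)) i  ≡⟨ lookup∘tabulate (i ==_) i ⟩
  (i == i)                  ≡⟨ ==-refl i ⟩
  true                      ∎)))
  where open ≡-Reasoning

-- 0 off the generators; colours are only ever read on edges.
generatorIndex : ∀ {k} → Vec Bool k → ℕ
generatorIndex d with any? (λ t → ≡-dec Bool._≟_ d (gen t))
... | yes (t , _) = toℕ t
... | no _ = 0

generatorIndex-gen : ∀ {a} (t : Fin (3 + a)) → generatorIndex (gen t) ≡ toℕ t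
generatorIndex-gen t with any? (λ s → ≡-dec Bool._≟_ (gen t) (gen s))
... | yes (s , e) = cong toℕ (gen-injective (sym e))
... | no ∄s = contradiction (t , refl) ∄s

-- Permutations

injective⇒surjective : ∀ {m} {f : Fin m → Fin m} → Injective _≡_ _≡_ f → ∀ y → ∃ λ x → f x ≡ y
injective⇒surjective {suc m} {f} f-injective y with any? (λ x → f x F.≟ y)
... | yes found = found
... | no ∄x = contradiction (injective⇒≤ {f = f∖y} f∖y-injective) ℕₚ.1+n≰n
  where
  f∖y : Fin (suc m) → Fin m
  f∖y x = punchOut {i = y} {j = f x} (λ e → ∄x (x , sym e))
  f∖y-injective : Injective _≡_ _≡_ f∖y
  f∖y-injective {x} {x'} e =
    f-injective (punchOut-injective {i = y} (λ e → ∄x (x , sym e)) (λ e → ∄x (x' , sym e)) e)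

injective⇒permutation : ∀ {m} (f : Fin m → Fin m) → Injective _≡_ _≡_ f → Permutation′ m
injective⇒permutation f f-injective = permutation f f⁻¹
  (λ y → proj₂ (injective⇒surjective f-injective y))
  (λ x → f-injective (proj₂ (injective⇒surjective f-injective (f x))))
  where
  f⁻¹ : Fin _ → Fin _
  f⁻¹ y = proj₁ (injective⇒surjective f-injective y)

lehmer : ∀ m → Fin (m !) → Permutation′ m
lehmer zero _ = Perm.id
lehmer (suc m) r = insert F.zero (proj₁ qr) (lehmer m (proj₂ qr))
  where
  qr : Fin (suc m) × Fin (m !)
  qr = remQuot {suc m} (m !) r

lehmer-injective : ∀ m {r s} → lehmer m r Perm.≈ lehmer m s → r ≡ s
lehmer-injective zero {F.zero} {F.zero} _ = refl
lehmer-injective (suc m) {r} {s} eq = begin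
  r                                    ≡⟨ combine-remQuot {suc m} (m !) r ⟨
  combine (proj₁ qr) (proj₂ qr)        ≡⟨ cong₂ combine heads tails ⟩
  combine (proj₁ qs) (proj₂ qs)        ≡⟨ combine-remQuot {suc m} (m !) s ⟩
  s                                    ∎
  where
  open ≡-Reasoning
  qr qs : Fin (suc m) × Fin (m !)
  qr = remQuot {suc m} (m !) r
  qs = remQuot {suc m} (m !) s
  heads : proj₁ qr ≡ proj₁ qs
  heads = eq F.zero
  πr πs : Permutation′ m
  πr = lehmer m (proj₂ qr)
  πs = lehmer m (proj₂ qs)
  tails : proj₂ qr ≡ proj₂ qs
  tails = lehmer-injective m λ k → punchIn-injective (proj₁ qr) _ _ (begin
    punchIn (proj₁ qr) (πr ⟨$⟩ʳ k)  ≡⟨ insert-punchIn F.zero _ πr k ⟨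
    lehmer (suc m) r ⟨$⟩ʳ F.suc k   ≡⟨ eq (F.suc k) ⟩
    lehmer (suc m) s ⟨$⟩ʳ F.suc k   ≡⟨ insert-punchIn F.zero _ πs k ⟩
    punchIn (proj₁ qs) (πs ⟨$⟩ʳ k)  ≡⟨ cong (λ i → punchIn i (πs ⟨$⟩ʳ k)) heads ⟨
    punchIn (proj₁ qr) (πs ⟨$⟩ʳ k)  ∎)

<-preserving⇒inflationary : ∀ {m} (h : Fin m → Fin m) → (∀ {s t} → s F.< t → h s F.< h t) →
                            ∀ t → t F.≤ h t
<-preserving⇒inflationary {suc m} h h-mono = <-weakInduction (λ t → t F.≤ h t) z≤n step
  where
  step : ∀ i → inject₁ i F.≤ h (inject₁ i) → F.suc i F.≤ h (F.suc i)
  step i ih = ℕₚ.≤-trans (s≤s (subst (_≤ toℕ (h (inject₁ i))) (toℕ-inject₁ i) ih))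
                        (h-mono {inject₁ i} {F.suc i} (s≤s (ℕₚ.≤-reflexive (toℕ-inject₁ i))))

order-isomorphic⇒≈ : ∀ {m} (π ρ : Permutation′ m) →
                     (∀ {i j} → π ⟨$⟩ʳ i F.< π ⟨$⟩ʳ j → ρ ⟨$⟩ʳ i F.< ρ ⟨$⟩ʳ j) →
                     (∀ {i j} → ρ ⟨$⟩ʳ i F.< ρ ⟨$⟩ʳ j → π ⟨$⟩ʳ i F.< π ⟨$⟩ʳ j) → π Perm.≈ ρ
order-isomorphic⇒≈ π ρ π⇒ρ ρ⇒π i = ≤-antisym π≤ρ ρ≤π
  where
  ρ∘π⁻¹-mono : ∀ {s t} → s F.< t → ρ ⟨$⟩ʳ (π ⟨$⟩ˡ s) F.< ρ ⟨$⟩ʳ (π ⟨$⟩ˡ t)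
  ρ∘π⁻¹-mono {s} {t} = π⇒ρ ∘′ subst₂ F._<_ (sym (inverseʳ π)) (sym (inverseʳ π))
  π∘ρ⁻¹-mono : ∀ {s t} → s F.< t → π ⟨$⟩ʳ (ρ ⟨$⟩ˡ s) F.< π ⟨$⟩ʳ (ρ ⟨$⟩ˡ t)
  π∘ρ⁻¹-mono {s} {t} = ρ⇒π ∘′ subst₂ F._<_ (sym (inverseʳ ρ)) (sym (inverseʳ ρ))
  π≤ρ : π ⟨$⟩ʳ i F.≤ ρ ⟨$⟩ʳ i
  π≤ρ = subst (π ⟨$⟩ʳ i F.≤_) (cong (ρ ⟨$⟩ʳ_) (Perm.inverseˡ π))
          (<-preserving⇒inflationary _ ρ∘π⁻¹-mono (π ⟨$⟩ʳ i))
  ρ≤π : ρ ⟨$⟩ʳ i F.≤ π ⟨$⟩ʳ i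
  ρ≤π = subst (ρ ⟨$⟩ʳ i F.≤_) (cong (π ⟨$⟩ʳ_) (Perm.inverseˡ ρ))
          (<-preserving⇒inflationary _ π∘ρ⁻¹-mono (ρ ⟨$⟩ʳ i))

data Arc {m} : Fin (suc m) → Fin (suc m) → Set where
  step : ∀ i → Arc (inject₁ i) (F.suc i)
  wrap : Arc (fromℕ m) F.zero

arcIndex : ∀ {m} {u v : Fin (suc m)} → Arc u v → Fin (suc m)
arcIndex (step i) = F.suc i
arcIndex wrap = F.zero

arcIndex-injective : ∀ {m} {u v u' v' : Fin (suc m)} (a : Arc u v) (a' : Arc u' v') →
                     arcIndex a ≡ arcIndex a' → u ≡ u' × v ≡ v'
arcIndex-injective (step i) (step .i) refl = refl , refl
arcIndex-injective wrap wrap _ = refl , refl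

CycleEdge : ∀ {m} → Fin (suc m) → Fin (suc m) → Set
CycleEdge u v = Arc u v ⊎ Arc v u

edgeIndex : ∀ {m} {u v : Fin (suc m)} → CycleEdge u v → Fin (suc m)
edgeIndex (inj₁ a) = arcIndex a
edgeIndex (inj₂ a) = arcIndex a

edgeIndex-injective : ∀ {m} {u v u' v' : Fin (suc m)} (e : CycleEdge u v) (e' : CycleEdge u' v') →
                      edgeIndex e ≡ edgeIndex e' → SameEdge u v u' v'
edgeIndex-injective (inj₁ a) (inj₁ a') eq = inj₁ (arcIndex-injective a a' eq)
edgeIndex-injective (inj₁ a) (inj₂ a') eq = inj₂ (arcIndex-injective a a' eq)
edgeIndex-injective (inj₂ a) (inj₁ a') eq = let (p , q) = arcIndex-injective a a' eq in inj₂ (q , p)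
edgeIndex-injective (inj₂ a) (inj₂ a') eq = let (p , q) = arcIndex-injective a a' eq in inj₁ (q , p)

step-arc : ∀ {m} {u v : Fin (suc m)} → suc (toℕ u) ≡ toℕ v → Arc u v
step-arc {u = u} {F.suc i} e
  with refl ← toℕ-injective {i = u} {j = inject₁ i} (trans (ℕₚ.suc-injective e) (sym (toℕ-inject₁ i)))
  = step i

wrap-arc : ∀ {m} {u v : Fin (suc m)} → suc (toℕ u) ≡ suc m → toℕ v ≡ 0 → Arc u v
wrap-arc {m} {u} {F.zero} e _
  with refl ← toℕ-injective {i = u} {j = fromℕ m} (trans (ℕₚ.suc-injective e) (sym (toℕ-fromℕ m)))
  = wrap

cycleG-edge : ∀ {m} (u v : Fin (suc m)) → cycleG (suc m) u v ≡ true → CycleEdge u v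
cycleG-edge u v e with ∨-true⁻ (proj₂ (∧-true⁻ {not (u == v)} e))
... | inj₁ forward = inj₁ (step-arc (==ℕ⇒≡ forward))
... | inj₂ e₁ with ∨-true⁻ e₁
...   | inj₁ backward = inj₂ (step-arc (==ℕ⇒≡ backward))
...   | inj₂ e₂ with ∨-true⁻ e₂
...     | inj₁ wrap-back = let (u≡0 , v≡m) = ∧-true⁻ wrap-back
                           in inj₂ (wrap-arc (==ℕ⇒≡ v≡m) (==ℕ⇒≡ u≡0))
...     | inj₂ wrap-fwd = let (v≡0 , u≡m) = ∧-true⁻ wrap-fwd
                          in inj₁ (wrap-arc (==ℕ⇒≡ u≡m) (==ℕ⇒≡ v≡0))

cycleG-wrap : ∀ m → cycleG (2 + m) (fromℕ (suc m)) F.zero ≡ true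
cycleG-wrap m = trans (cong (B ∨_) (≡⇒==ℕ (cong (2 +_) (toℕ-fromℕ m)))) (∨-zeroʳ B)
  where
  B : Bool
  B = 1 ==ℕ toℕ (fromℕ (suc m))

pathG-step : ∀ {m} (i : Fin m) → pathG m (inject₁ i) (F.suc i) ≡ true
pathG-step {m} i =
  cong (_∨ (suc (toℕ (F.suc i)) ==ℕ toℕ (inject₁ i))) (≡⇒==ℕ (cong suc (toℕ-inject₁ i)))

step-sameEdge : ∀ {m} {i j : Fin m} → SameEdge (inject₁ i) (F.suc i) (inject₁ j) (F.suc j) → i ≡ j
step-sameEdge (inj₁ (_ , e)) = suc-injective e
step-sameEdge {i = i} {j} (inj₂ (e₁ , e₂)) = contradiction j≡2+j (ℕₚ.m≢1+n+m (toℕ j) {1})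
  where
  j≡2+j : toℕ j ≡ 2 + toℕ j
  j≡2+j = begin
    toℕ j              ≡⟨ toℕ-inject₁ j ⟨
    toℕ (inject₁ j)    ≡⟨ cong toℕ e₂ ⟨
    suc (toℕ i)        ≡⟨ cong suc (toℕ-inject₁ i) ⟨
    suc (toℕ (inject₁ i)) ≡⟨ cong (suc ∘ toℕ) e₁ ⟩
    2 + toℕ j          ∎
    where open ≡-Reasoning

module _ {k} (π : Permutation′ k) where

  flipped : Fin (suc k) → Vec Bool k
  flipped i = tabulate λ j → does (toℕ (π ⟨$⟩ʳ j) <? toℕ i)

  lookup-flipped : ∀ i j → lookup (flipped i) j ≡ does (toℕ (π ⟨$⟩ʳ j) <? toℕ i)
  lookup-flipped i j = lookup∘tabulate (λ j → does (toℕ (π ⟨$⟩ʳ j) <? toℕ i)) j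

  lookup-flipped-⊕ : ∀ i i' j → lookup (flipped i ⊕ flipped i') j ≡
                     does (toℕ (π ⟨$⟩ʳ j) <? toℕ i) xor does (toℕ (π ⟨$⟩ʳ j) <? toℕ i')
  lookup-flipped-⊕ i i' j =
    trans (lookup-⊕ (flipped i) (flipped i') j) (cong₂ _xor_ (lookup-flipped i j) (lookup-flipped i' j))

  flipped-step : ∀ i → flipped (inject₁ i) ⊕ flipped (F.suc i) ≡ gen (F.suc (π ⟨$⟩ˡ i))
  flipped-step i = ≗⇒≡ λ j → begin
    lookup (flipped (inject₁ i) ⊕ flipped (F.suc i)) j
      ≡⟨ lookup-flipped-⊕ (inject₁ i) (F.suc i) j ⟩
    does (p j <? toℕ (inject₁ i)) xor does (p j <? suc (toℕ i))
      ≡⟨ cong₂ (λ n n' → does (p j <? n) xor n') (toℕ-inject₁ i) (<?-suc (p j) (toℕ i)) ⟩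
    does (p j <? toℕ i) xor (does (p j <? toℕ i) xor does (p j ≟ toℕ i))
      ≡⟨ xor-cancelˡ (does (p j <? toℕ i)) _ ⟩
    does (p j ≟ toℕ i)
      ≡⟨ does-⇔ (mk⇔ (step-at j) (stepped j)) (p j ≟ toℕ i) ((π ⟨$⟩ˡ i) F.≟ j) ⟩
    ((π ⟨$⟩ˡ i) == j)
      ≡⟨ lookup∘tabulate ((π ⟨$⟩ˡ i) ==_) j ⟨
    lookup (gen (F.suc (π ⟨$⟩ˡ i))) j ∎
    where
    open ≡-Reasoning
    p : Fin k → ℕ
    p j = toℕ (π ⟨$⟩ʳ j)
    step-at : ∀ j → p j ≡ toℕ i → π ⟨$⟩ˡ i ≡ j
    step-at j e = trans (cong (π ⟨$⟩ˡ_) (sym (toℕ-injective e))) (inverseˡ π)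
    stepped : ∀ j → π ⟨$⟩ˡ i ≡ j → p j ≡ toℕ i
    stepped j refl = cong toℕ (inverseʳ π)

  flipped-zero : flipped F.zero ≡ replicate k false
  flipped-zero = ≗⇒≡ λ j → trans (lookup-flipped F.zero j)
    (trans (dec-false (toℕ (π ⟨$⟩ʳ j) <? 0) λ ()) (sym (lookup-replicate j false)))

  flipped-last : flipped (fromℕ k) ≡ replicate k true
  flipped-last = ≗⇒≡ λ j → trans (lookup-flipped (fromℕ k) j)
    (trans (dec-true (toℕ (π ⟨$⟩ʳ j) <? toℕ (fromℕ k))
                     (subst (toℕ (π ⟨$⟩ʳ j) <_) (sym (toℕ-fromℕ k)) (toℕ<n _)))
           (sym (lookup-replicate j true)))

  flipped-wrap : flipped (fromℕ k) ⊕ flipped F.zero ≡ gen F.zero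
  flipped-wrap = trans (cong₂ _⊕_ flipped-last flipped-zero) (zipWith-replicate _xor_ true false)

  edgeGenerator : ∀ {u v} → CycleEdge u v → Fin (suc k)
  edgeGenerator e = lift₀ (Perm.flip π) ⟨$⟩ʳ edgeIndex e

  flipped-arc : ∀ {u v} (a : Arc u v) → flipped u ⊕ flipped v ≡ gen (edgeGenerator (inj₁ a))
  flipped-arc (step i) = flipped-step i
  flipped-arc wrap = flipped-wrap

  flipped-edge : ∀ {u v} (e : CycleEdge u v) → flipped u ⊕ flipped v ≡ gen (edgeGenerator e)
  flipped-edge (inj₁ a) = flipped-arc a
  flipped-edge {u} {v} (inj₂ a) = trans (⊕-comm (flipped u) (flipped v)) (flipped-arc a)

  edgeGenerator-injective : ∀ {u v u' v'} (e : CycleEdge u v) (e' : CycleEdge u' v') →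
                            edgeGenerator e ≡ edgeGenerator e' → SameEdge u v u' v'
  edgeGenerator-injective e e' eq =
    edgeIndex-injective e e' (Injection.injective (↔⇒↣ (lift₀ (Perm.flip π))) eq)

  flipped-separates : ∀ {u v} → u F.< v → flipped u ≢ flipped v
  flipped-separates {u} {v} u<v e = contradiction (begin
    false                                        ≡⟨ dec-false (toℕ u <? toℕ u) (ℕₚ.<-irrefl refl) ⟨
    does (toℕ u <? toℕ u)                        ≡⟨ cong (λ n → does (n <? toℕ u)) πj≡u ⟨
    does (toℕ (π ⟨$⟩ʳ j) <? toℕ u)               ≡⟨ lookup-flipped u j ⟨
    lookup (flipped u) j                         ≡⟨ cong (λ f → lookup f j) e ⟩
    lookup (flipped v) j                         ≡⟨ lookup-flipped v j ⟩
    does (toℕ (π ⟨$⟩ʳ j) <? toℕ v)               ≡⟨ cong (λ n → does (n <? toℕ v)) πj≡u ⟩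
    does (toℕ u <? toℕ v)                        ≡⟨ dec-true (toℕ u <? toℕ v) u<v ⟩
    true                                         ∎) λ ()
    where
    open ≡-Reasoning
    u<k : toℕ u < k
    u<k = ℕₚ.<-≤-trans u<v (s≤s⁻¹ (toℕ<n v))
    j : Fin k
    j = π ⟨$⟩ˡ fromℕ< u<k
    πj≡u : toℕ (π ⟨$⟩ʳ j) ≡ toℕ u
    πj≡u = trans (cong toℕ (inverseʳ π)) (toℕ-fromℕ< u<k)

  flipped-injective : Injective _≡_ _≡_ flipped
  flipped-injective {u} {v} e with <-cmp u v
  ... | tri< u<v _ _ = contradiction e (flipped-separates u<v)
  ... | tri≈ _ u≡v _ = u≡v
  ... | tri> _ _ v<u = contradiction (sym e) (flipped-separates v<u)

-- Step π j + 1 has flipped coordinate j but not j₂, hence separates π′ j from π′ j₂.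
flipped-order : ∀ {k} (π π' : Permutation′ k) {i' j j₂} →
                flipped π' i' ≡ flipped π (F.suc (π ⟨$⟩ʳ j)) →
                π ⟨$⟩ʳ j F.< π ⟨$⟩ʳ j₂ → π' ⟨$⟩ʳ j F.< π' ⟨$⟩ʳ j₂
flipped-order π π' {i'} {j} {j₂} same πj<πj₂ = ℕₚ.<-≤-trans π'j<i' i'≤π'j₂
  where
  i : Fin (suc _)
  i = F.suc (π ⟨$⟩ʳ j)
  agree : ∀ j' → does (toℕ (π' ⟨$⟩ʳ j') <? toℕ i') ≡ does (toℕ (π ⟨$⟩ʳ j') <? toℕ i)
  agree j' = trans (sym (lookup-flipped π' i' j'))
               (trans (cong (λ f → lookup f j') same) (lookup-flipped π i j'))
  π'j<i' : π' ⟨$⟩ʳ j F.< i'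
  π'j<i' = dec-true⁻ (toℕ (π' ⟨$⟩ʳ j) <? toℕ i')
             (trans (agree j) (dec-true (toℕ (π ⟨$⟩ʳ j) <? toℕ i) (ℕₚ.n<1+n _)))
  i'≤π'j₂ : i' F.≤ π' ⟨$⟩ʳ j₂
  i'≤π'j₂ = ℕₚ.≮⇒≥ (dec-false⁻ (toℕ (π' ⟨$⟩ʳ j₂) <? toℕ i')
              (trans (agree j₂) (dec-false (toℕ (π ⟨$⟩ʳ j₂) <? toℕ i) (ℕₚ.<⇒≱ πj<πj₂ ∘ s≤s⁻¹))))

-- The folded cubes

toBits : ∀ m → Fin (2 ^ m) → Vec Bool m
toBits zero _ = []
toBits (suc m) i = Inverse.to 2↔Bool (proj₁ (remQuot {2} (2 ^ m) i)) ∷ toBits m (proj₂ (remQuot {2} (2 ^ m) i))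

fromBits : ∀ {m} → Vec Bool m → Fin (2 ^ m)
fromBits [] = F.zero
fromBits (b ∷ x) = combine (Inverse.from 2↔Bool b) (fromBits x)

toBits-fromBits : ∀ {m} (x : Vec Bool m) → toBits m (fromBits x) ≡ x
toBits-fromBits [] = refl
toBits-fromBits {suc m} (b ∷ x) = trans
  (cong (λ p → Inverse.to 2↔Bool (proj₁ p) ∷ toBits m (proj₂ p))
        (remQuot-combine {2} {2 ^ m} (Inverse.from 2↔Bool b) (fromBits x)))
  (cong₂ _∷_ (Inverse.strictlyInverseˡ 2↔Bool b) (toBits-fromBits x))

fromBits-toBits : ∀ m (i : Fin (2 ^ m)) → fromBits (toBits m i) ≡ i
fromBits-toBits zero F.zero = refl
fromBits-toBits (suc m) i = begin
  combine (Inverse.from 2↔Bool (Inverse.to 2↔Bool b)) (fromBits (toBits m r))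
    ≡⟨ cong₂ combine (Inverse.strictlyInverseʳ 2↔Bool b) (fromBits-toBits m r) ⟩
  combine b r
    ≡⟨ combine-remQuot {2} (2 ^ m) i ⟩
  i ∎
  where
  open ≡-Reasoning
  b : Fin 2
  b = proj₁ (remQuot {2} (2 ^ m) i)
  r : Fin (2 ^ m)
  r = proj₂ (remQuot {2} (2 ^ m) i)

toBits-injective : ∀ m → Injective _≡_ _≡_ (toBits m)
toBits-injective m {i} {j} e =
  trans (sym (fromBits-toBits m i)) (trans (cong fromBits e) (fromBits-toBits m j))

module FoldedCubes (q a : ℕ) where

  k : ℕ
  k = 2 + a

  N : ℕ
  N = q * 2 ^ k

  opaque
    block : Fin N → Fin q
    block u = proj₁ (remQuot {q} (2 ^ k) u)

    bits : Fin N → Vec Bool k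
    bits u = toBits k (proj₂ (remQuot {q} (2 ^ k) u))

    vertex : Fin q → Vec Bool k → Fin N
    vertex b x = combine b (fromBits x)

    block-vertex : ∀ b x → block (vertex b x) ≡ b
    block-vertex b x = cong proj₁ (remQuot-combine b (fromBits x))

    bits-vertex : ∀ b x → bits (vertex b x) ≡ x
    bits-vertex b x = trans (cong (toBits k ∘ proj₂) (remQuot-combine b (fromBits x))) (toBits-fromBits x)

    vertex-block-bits : ∀ u → vertex (block u) (bits u) ≡ u
    vertex-block-bits u = trans (cong (combine (block u)) (fromBits-toBits k _)) (combine-remQuot {q} (2 ^ k) u)

    block-bits-injective : ∀ {u v} → block u ≡ block v → bits u ≡ bits v → u ≡ v
    block-bits-injective {u} {v} eb ex =
      trans (sym (vertex-block-bits u)) (trans (cong₂ vertex eb ex) (vertex-block-bits v))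

  Adjacent : Fin N → Fin N → Set
  Adjacent u v = block u ≡ block v × ∃ λ t → bits u ⊕ bits v ≡ gen t

  adjacent? : ∀ u v → Dec (Adjacent u v)
  adjacent? u v = (block u F.≟ block v) ×-dec any? (λ t → ≡-dec Bool._≟_ (bits u ⊕ bits v) (gen t))

  SameEdge⇒⊕≡ : ∀ {u v u' v'} → SameEdge u v u' v' → bits u ⊕ bits v ≡ bits u' ⊕ bits v'
  SameEdge⇒⊕≡ (inj₁ (refl , refl)) = refl
  SameEdge⇒⊕≡ {u} {v} (inj₂ (refl , refl)) = ⊕-comm (bits u) (bits v)

  Adjacent-sym : ∀ {u v} → Adjacent u v → Adjacent v u
  Adjacent-sym {u} {v} (eb , t , e) = sym eb , t , trans (⊕-comm (bits v) (bits u)) e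

  opaque
    G : Graph N
    G u v = does (adjacent? u v)

    c : Coloring N
    c u v = generatorIndex (bits u ⊕ bits v)

    G⇒Adjacent : ∀ {u v} → G u v ≡ true → Adjacent u v
    G⇒Adjacent {u} {v} = dec-true⁻ (adjacent? u v)

    Adjacent⇒G : ∀ {u v} → Adjacent u v → G u v ≡ true
    Adjacent⇒G {u} {v} = dec-true (adjacent? u v)

    c-gen : ∀ {u v t} → bits u ⊕ bits v ≡ gen t → c u v ≡ toℕ t
    c-gen {t = t} e = trans (cong generatorIndex e) (generatorIndex-gen t)

    G-simple : Simple G
    G-simple = record
      { sym = λ u v → does-⇔ (mk⇔ Adjacent-sym Adjacent-sym) (adjacent? u v) (adjacent? v u)
      ; irrefl = λ u → dec-false (adjacent? u u) λ (_ , t , e) →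
          gen-nonzero t (trans (sym e) (⊕-self (bits u)))
      }

    c-proper : ProperColoring G c
    c-proper = record
      { symm = λ u v _ → cong generatorIndex (⊕-comm (bits u) (bits v))
      ; proper = λ u v w uv uw v≢w c≡ → v≢w (same-colour u v w (G⇒Adjacent uv) (G⇒Adjacent uw) c≡)
      }
      where
      same-colour : ∀ u v w → Adjacent u v → Adjacent u w → c u v ≡ c u w → v ≡ w
      same-colour u v w (uv-block , s , uv-gen) (uw-block , t , uw-gen) c≡ =
        block-bits-injective (trans (sym uv-block) uw-block)
          (⊕-injectiveʳ (bits u) (trans uv-gen (trans (cong gen s≡t) (sym uw-gen))))
        where
        s≡t : s ≡ t
        s≡t = toℕ-injective (trans (sym (c-gen uv-gen)) (trans c≡ (c-gen uw-gen)))

  ¬rainbow-path : ∀ {p} → ¬ IsRainbowEmbedding (pathG (suc k)) G c p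
  ¬rainbow-path {p} emb = last≢zero (injective (block-bits-injective blocks bits≡))
    where
    open IsRainbowEmbedding emb

    adjacent : ∀ i → Adjacent (p (inject₁ i)) (p (F.suc i))
    adjacent i = G⇒Adjacent (edge-preserving (pathG-step i))

    t : Fin (suc k) → Fin (suc k)
    t i = proj₁ (proj₂ (adjacent i))

    t-gen : ∀ i → bits (p (inject₁ i)) ⊕ bits (p (F.suc i)) ≡ gen (t i)
    t-gen i = proj₂ (proj₂ (adjacent i))

    t-injective : Injective _≡_ _≡_ t
    t-injective {i} {j} e = step-sameEdge (rainbow (pathG-step i) (pathG-step j)
      (trans (c-gen (t-gen i)) (trans (cong toℕ e) (sym (c-gen (t-gen j))))))

    blocks : block (p (fromℕ (suc k))) ≡ block (p F.zero)
    blocks = ≡-along-steps (block ∘ p) (proj₁ ∘ adjacent)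

    bit≡ : ∀ j → lookup (bits (p (fromℕ (suc k)))) j ≡ lookup (bits (p F.zero)) j
    bit≡ j = begin
      B (fromℕ (suc k))
        ≡⟨ xor-telescope B ⟩
      B F.zero xor ∑[ i < suc k ] (B (inject₁ i) xor B (F.suc i))
        ≡⟨ cong (B F.zero xor_) (sum-cong-≗ step-bit) ⟩
      B F.zero xor ∑[ i < suc k ] lookup (gen (t i)) j
        ≡⟨ cong (B F.zero xor_) (sum-permute (λ s → lookup (gen s) j) (injective⇒permutation t t-injective)) ⟨
      B F.zero xor ∑[ s < suc k ] lookup (gen s) j
        ≡⟨ cong (B F.zero xor_) (∑-gen j) ⟩
      B F.zero xor false
        ≡⟨ xor-identityʳ (B F.zero) ⟩
      B F.zero ∎
      where
      open ≡-Reasoning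
      B : Fin (2 + k) → Bool
      B i = lookup (bits (p i)) j
      step-bit : ∀ i → (B (inject₁ i) xor B (F.suc i)) ≡ lookup (gen (t i)) j
      step-bit i = trans (sym (lookup-⊕ (bits (p (inject₁ i))) _ j)) (cong (λ v → lookup v j) (t-gen i))

    bits≡ : bits (p (fromℕ (suc k))) ≡ bits (p F.zero)
    bits≡ = ≗⇒≡ bit≡

    last≢zero : fromℕ (suc k) ≢ F.zero
    last≢zero ()

  noRainbowPath : NoRainbow (pathG (suc k)) G c
  noRainbowPath φ with rainbowEmb (pathG (suc k)) G c φ in e
  ... | false = refl
  ... | true = ⊥-elim (¬rainbow-path (rainbowEmb⁻ φ e))

module RainbowCycles (q a : ℕ) where
  open FoldedCubes q a

  -- Step i of the cycle W flips coordinate π⁻¹ i, the closing step flips all of them.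
  module Cycle (b : Fin q) (x : Vec Bool k) (π : Permutation′ k) where

    W : Fin (suc k) → Fin N
    W i = vertex b (x ⊕ flipped π i)

    bits-W : ∀ i → bits (W i) ≡ x ⊕ flipped π i
    bits-W i = bits-vertex b (x ⊕ flipped π i)

    W-edge : ∀ {u v} (e : CycleEdge u v) → bits (W u) ⊕ bits (W v) ≡ gen (edgeGenerator π e)
    W-edge {u} {v} e = trans (cong₂ _⊕_ (bits-W u) (bits-W v))
                             (trans (⊕-cancel-common x (flipped π u) (flipped π v)) (flipped-edge π e))

    W-injective : Injective _≡_ _≡_ W
    W-injective {u} {v} e = flipped-injective π (⊕-injectiveʳ x (begin
      x ⊕ flipped π u   ≡⟨ bits-W u ⟨
      bits (W u)        ≡⟨ cong bits e ⟩
      bits (W v)        ≡⟨ bits-W v ⟩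
      x ⊕ flipped π v   ∎))
      where open ≡-Reasoning

    W-adjacent : ∀ {u v} → CycleEdge u v → Adjacent (W u) (W v)
    W-adjacent {u} {v} e =
      trans (block-vertex b (x ⊕ flipped π u)) (sym (block-vertex b (x ⊕ flipped π v))) ,
      edgeGenerator π e , W-edge e

    W-rainbow : IsRainbowEmbedding (cycleG (suc k)) G c W
    W-rainbow = record
      { injective = W-injective
      ; edge-preserving = λ {u} {v} h → Adjacent⇒G (W-adjacent (cycleG-edge u v h))
      ; rainbow = λ {u} {v} {u'} {v'} h h' eq → edgeGenerator-injective π (cycleG-edge u v h) (cycleG-edge u' v' h')
          (toℕ-injective (trans (sym (c-gen (W-edge (cycleG-edge u v h))))
                                (trans eq (c-gen (W-edge (cycleG-edge u' v' h'))))))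
      }

    cycle : Vec (Fin N) (suc k)
    cycle = tabulate W

    lookup-cycle : ∀ i → lookup cycle i ≡ W i
    lookup-cycle = lookup∘tabulate W

    cycle-rainbow : rainbowEmb (cycleG (suc k)) G c cycle ≡ true
    cycle-rainbow = rainbowEmb⁺ cycle (IsRainbowEmbedding-cong (sym ∘ lookup-cycle) W-rainbow)

    edge-with-gen-zero : ∀ {u v} (e : CycleEdge u v) → bits (W u) ⊕ bits (W v) ≡ gen F.zero →
                         SameEdge u v (fromℕ k) F.zero
    edge-with-gen-zero e eq =
      edgeGenerator-injective π e (inj₁ wrap) (gen-injective (trans (sym (W-edge e)) eq))

    bits-W-zero : bits (W F.zero) ≡ x
    bits-W-zero =
      trans (bits-W F.zero) (trans (cong (x ⊕_) (flipped-zero π)) (zipWith-identityʳ xor-identityʳ x))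

    bits-W-last : bits (W (fromℕ k)) ≡ x ⊕ replicate k true
    bits-W-last = trans (bits-W (fromℕ k)) (cong (x ⊕_) (flipped-last π))

  module _ {b b' : Fin q} {x x' : Vec Bool k} {π π' : Permutation′ k} where
    private
      module C = Cycle b x π
      module C' = Cycle b' x' π'

    -- The closing edge is the only edge of a cycle with generator 1, so the closing edges of
    -- two cycles with the same image coincide, and x is the endpoint with first bit 0.
    wrap-preimage : ∀ {u' v'} → cycleG (suc k) u' v' ≡ true →
                    SameEdge (C'.W u') (C'.W v') (C.W (fromℕ k)) (C.W F.zero) →
                    C'.W F.zero ≡ C.W (fromℕ k) ⊎ C'.W F.zero ≡ C.W F.zero
    wrap-preimage {u'} {v'} h' same = SameEdge-endpoint C'.W ends same
      where
      ends : SameEdge u' v' (fromℕ k) F.zero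
      ends = C'.edge-with-gen-zero (cycleG-edge u' v' h')
               (trans (SameEdge⇒⊕≡ same) (C.W-edge (inj₁ wrap)))

    start-determined : C'.W F.zero ≡ C.W (fromℕ k) ⊎ C'.W F.zero ≡ C.W F.zero →
                       lookup x F.zero ≡ false → lookup x' F.zero ≡ false → b' ≡ b × x' ≡ x
    start-determined (inj₁ e) x₀ x'₀ = contradiction (begin
      false                                    ≡⟨ x'₀ ⟨
      lookup x' F.zero                         ≡⟨ cong (λ y → lookup y F.zero) C'.bits-W-zero ⟨
      lookup (bits (C'.W F.zero)) F.zero       ≡⟨ cong (λ w → lookup (bits w) F.zero) e ⟩
      lookup (bits (C.W (fromℕ k))) F.zero     ≡⟨ cong (λ y → lookup y F.zero) C.bits-W-last ⟩
      lookup (x ⊕ replicate k true) F.zero     ≡⟨ lookup-⊕ x (replicate k true) F.zero ⟩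
      lookup x F.zero xor true                 ≡⟨ cong (_xor true) x₀ ⟩
      true                                     ∎) λ ()
      where open ≡-Reasoning
    start-determined (inj₂ e) _ _ =
      trans (sym (block-vertex b' (x' ⊕ flipped π' F.zero)))
            (trans (cong block e) (block-vertex b (x ⊕ flipped π F.zero))) ,
      trans (sym C'.bits-W-zero) (trans (cong bits e) C.bits-W-zero)

    image-cycle-start : image (cycleG (suc k)) G c C.cycle ≡ image (cycleG (suc k)) G c C'.cycle →
                        lookup x F.zero ≡ false → lookup x' F.zero ≡ false → b' ≡ b × x' ≡ x
    image-cycle-start eq =
      let (u' , v' , h' , same) = image-edge (cycleG (suc k)) G c C.cycle C'.cycle eq
                                             {fromℕ k} {F.zero} (cycleG-wrap (suc a))
      in start-determined (wrap-preimage {u'} {v'} h'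
           (SameEdge-resp (C'.lookup-cycle u') (C'.lookup-cycle v')
                          (C.lookup-cycle (fromℕ k)) (C.lookup-cycle F.zero) same))

  module _ {b : Fin q} {x : Vec Bool k} {π π' : Permutation′ k} where
    private
      module C = Cycle b x π
      module C' = Cycle b x π'

    image-cycle-order : image (cycleG (suc k)) G c C.cycle ≡ image (cycleG (suc k)) G c C'.cycle →
                        ∀ {j j₂} → π ⟨$⟩ʳ j F.< π ⟨$⟩ʳ j₂ → π' ⟨$⟩ʳ j F.< π' ⟨$⟩ʳ j₂
    image-cycle-order eq {j} {j₂} =
      let (i' , e) = image-vertex (cycleG (suc k)) G c C.cycle C'.cycle eq (F.suc (π ⟨$⟩ʳ j))
      in flipped-order π π' {i'} (same-vertex⇒same-flips {i'} {F.suc (π ⟨$⟩ʳ j)}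
           (trans (sym (C'.lookup-cycle i')) (trans e (C.lookup-cycle (F.suc (π ⟨$⟩ʳ j))))))
      where
      same-vertex⇒same-flips : ∀ {i' i} → C'.W i' ≡ C.W i → flipped π' i' ≡ flipped π i
      same-vertex⇒same-flips {i'} {i} e =
        ⊕-injectiveʳ x (trans (sym (C'.bits-W i')) (trans (cong bits e) (C.bits-W i)))

  image-cycle-parameters : ∀ {b b' y y' π π'} →
    image (cycleG (suc k)) G c (Cycle.cycle b (false ∷ y) π) ≡
    image (cycleG (suc k)) G c (Cycle.cycle b' (false ∷ y') π') →
    b ≡ b' × y ≡ y' × π Perm.≈ π'
  image-cycle-parameters {b} {b'} {y} {y'} {π} {π'} eq =
    let (b'≡b , x'≡x) = image-cycle-start {b} {b'} {false ∷ y} {false ∷ y'} {π} {π'} eq refl refl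
    in same-start⇒same-order (sym b'≡b) (sym (∷-injectiveʳ x'≡x)) eq
    where
    same-start⇒same-order : ∀ {b b' y y'} → b ≡ b' → y ≡ y' →
      image (cycleG (suc k)) G c (Cycle.cycle b (false ∷ y) π) ≡
      image (cycleG (suc k)) G c (Cycle.cycle b' (false ∷ y') π') →
      b ≡ b' × y ≡ y' × π Perm.≈ π'
    same-start⇒same-order {b} {y = y} refl refl eq =
      refl , refl , order-isomorphic⇒≈ π π' (image-cycle-order {b} {false ∷ y} {π} {π'} eq)
                                             (image-cycle-order {b} {false ∷ y} {π'} {π} (sym eq))

  K : ℕ
  K = q * (2 ^ suc a * k !)

  block-of : Fin K → Fin q
  block-of z = proj₁ (remQuot {q} (2 ^ suc a * k !) z)

  start-of : Fin K → Fin (2 ^ suc a)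
  start-of z = proj₁ (remQuot {2 ^ suc a} (k !) (proj₂ (remQuot {q} (2 ^ suc a * k !) z)))

  order-of : Fin K → Fin (k !)
  order-of z = proj₂ (remQuot {2 ^ suc a} (k !) (proj₂ (remQuot {q} (2 ^ suc a * k !) z)))

  combine-parameters : ∀ z → combine (block-of z) (combine (start-of z) (order-of z)) ≡ z
  combine-parameters z =
    trans (cong (combine (block-of z)) (combine-remQuot {2 ^ suc a} (k !) _)) (combine-remQuot {q} _ z)

  cycleAt : Fin K → Vec (Fin N) (suc k)
  cycleAt z = Cycle.cycle (block-of z) (false ∷ toBits (suc a) (start-of z)) (lehmer k (order-of z))

  image∘cycleAt-injective : Injective _≡_ _≡_ (image (cycleG (suc k)) G c ∘ cycleAt)
  image∘cycleAt-injective {z} {z'} eq =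
    let (b≡ , y≡ , π≈) = image-cycle-parameters
                           {block-of z} {block-of z'} {toBits (suc a) (start-of z)} {toBits (suc a) (start-of z')}
                           {lehmer k (order-of z)} {lehmer k (order-of z')} eq
        start≡ = toBits-injective (suc a) y≡
        order≡ = lehmer-injective k π≈
    in begin
      z                                                            ≡⟨ combine-parameters z ⟨
      combine (block-of z) (combine (start-of z) (order-of z))     ≡⟨ cong₂ combine b≡ (cong₂ combine start≡ order≡) ⟩
      combine (block-of z') (combine (start-of z') (order-of z'))  ≡⟨ combine-parameters z' ⟩
      z'                                                           ∎
    where open ≡-Reasoning

  ≤-rainbowCount-cycles : K ≤ rainbowCount (cycleG (suc k)) G c
  ≤-rainbowCount-cycles = ≤-rainbowCount (cycleG (suc k)) G c cycleAt
    (λ z → Cycle.cycle-rainbow (block-of z) (false ∷ toBits (suc a) (start-of z)) (lehmer k (order-of z)))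
    image∘cycleAt-injective

⌊m/2⌋*[q*2x]≤q*[x*m] : ∀ m q x → (m / 2) * (q * (2 * x)) ≤ q * (x * m)
⌊m/2⌋*[q*2x]≤q*[x*m] m q x = begin
  (m / 2) * (q * (2 * x))  ≡⟨ rearrange (m / 2) q x ⟩
  q * (x * ((m / 2) * 2))  ≤⟨ ℕₚ.*-monoʳ-≤ q (ℕₚ.*-monoʳ-≤ x (m/n*n≤m m 2)) ⟩
  q * (x * m)              ∎
  where
  open ℕₚ.≤-Reasoning
  rearrange : ∀ h q x → h * (q * (2 * x)) ≡ q * (x * (h * 2))
  rearrange = solve-∀

theorem4 : ∀ (ℓ n m : ℕ) → 3 ≤ ℓ → 0 < n → 2 ^ (ℓ ∸ 1) ∣ n →
    IsExStar n (cycleG ℓ) (pathG ℓ) m →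
    ((ℓ ∸ 1) ! / 2) * n ≤ m
theorem4 (suc (suc (suc a))) n m (s≤s (s≤s (s≤s _))) _ (divides q refl) ex = begin
  (k ! / 2) * (q * 2 ^ k)                 ≤⟨ ⌊m/2⌋*[q*2x]≤q*[x*m] (k !) q (2 ^ suc a) ⟩
  q * (2 ^ suc a * k !)                   ≤⟨ ≤-rainbowCount-cycles ⟩
  rainbowCount (cycleG (suc k)) G c       ≤⟨ IsExStar.upper ex G c G-simple c-proper noRainbowPath ⟩
  m                                       ∎
  where
  open ℕₚ.≤-Reasoning
  open FoldedCubes q a
  open RainbowCycles q a
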